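{- Let $G$ be a graph with vertices $v_1,\dots,v_n$, let $a_1,\dots,a_n\ge2$ be integers and $G_n=G(a_1,\dots,a_n)$. Then for all nonzero real $x_1,\dots,x_n$, $$\widetilde P_{G_n}(\mathbf{x})=x_1x_2\cdots x_n\cdot f_n\Bigl(a_1+\tfrac1{x_1},a_2+\tfrac1{x_2},\dots,a_n+\tfrac1{x_n}\Bigr),$$ and for every nonzero real $x$, $$U_{G_n}(x)=(-x)^n\cdot f_n\Bigl(a_1-\tfrac1x,a_2-\tfrac1x,\dots,a_n-\tfrac1x\Bigr).$$
   Context: Clique extension of the first kind: for a graph $G$ with vertex set $\{v_1,\dots,v_n\}$ and positive integers $a_1,\dots,a_n$, glue to each $v_i$ a complete graph $K_{a_i}$ on $a_i$ vertices (pairwise disjoint cliques, $K_{a_i}$ meeting $G$ only in $v_i$); the resulting graph is $G(a_1,\dots,a_n)$. The reduced independence polynomial of $G_n=G(a_1,\dots,a_n)$ is $\widetilde P_{G_n}(x_1,\dots,x_n)=\sum_I\prod_{u\in I}x_{c(u)}$ over all independent sets $I$ of $G_n$ (empty set contributes $1$), where $c(u)=i$ if $u\in K_{a_i}$. The monovariate signed independence polynomial of a graph $H$ is $U_H(x)=\sum_I(-x)^{|I|}$ over all independent sets $I$ of $H$. The polynomial $f_n=f_n(a_1,\dots,a_n)$ associated with $G$ is the unique real polynomial in $a_1,\dots,a_n$ of degree at most $1$ in each variable such that for all integers $a_1,\dots,a_n\ge2$, $f_n(a_1,\dots,a_n)$ equals the number of independent sets with $n$ vertices in $G(a_1,\dots,a_n)$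 (i.e., the leading coefficient of $\widetilde P_{G_n}$). -}

module Defs where

open import Level using (Level)
open import Data.Nat using (ℕ; zero; suc)
open import Data.Fin using (Fin; toℕ) renaming (zero to fz; suc to fs)
import Data.Fin as F
import Data.Nat as N
open import Data.Bool using (Bool; true; false; _∧_; not; if_then_else_)
open import Data.List using (List; []; _∷_; _++_; map; foldr; length; concatMap; allFin; filterᵇ)
open import Data.Product using (Σ; _,_; proj₁; proj₂; _×_)
open import Relation.Nullary.Decidable using (⌊_⌋)
open import Relation.Binary.PropositionalEquality using (_≡_)
open import Algebra.Bundles using (CommutativeRing)

record Graph (n : ℕ) : Set where
  field
    adj    : Fin n → Fin n → Bool
    sym    : ∀ i j → adj i j ≡ adj j i
    irrefl : ∀ i → adj i i ≡ false
open Graph public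

-- Vertices of G(a_1,…,a_n): a pair (i , j) with j : Fin (a i) is the j-th vertex
-- of the clique K_{a_i}; j = 0 is the original vertex v_i itself.
Vtx : (n : ℕ) → (Fin n → ℕ) → Set
Vtx n a = Σ (Fin n) (λ i → Fin (a i))

isZero : ∀ {m} → Fin m → Bool
isZero fz = true
isZero (fs _) = false

extAdj : ∀ {n} (G : Graph n) (a : Fin n → ℕ) → Vtx n a → Vtx n a → Bool
extAdj G a (i , j) (i' , j') =
  if ⌊ i F.≟ i' ⌋
  then not ⌊ toℕ j N.≟ toℕ j' ⌋
  else (isZero j ∧ (isZero j' ∧ adj G i i'))

extVerts : (n : ℕ) (a : Fin n → ℕ) → List (Vtx n a)
extVerts n a = concatMap (λ i → map (λ j → (i , j)) (allFin (a i))) (allFin n)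

-- all sub-lists (= subsets, for a repetition-free list)
subsets : ∀ {A : Set} → List A → List (List A)
subsets [] = [] ∷ []
subsets (x ∷ xs) = subsets xs ++ map (x ∷_) (subsets xs)

allᵇ : ∀ {A : Set} → (A → Bool) → List A → Bool
allᵇ p [] = true
allᵇ p (x ∷ xs) = p x ∧ allᵇ p xs

independent : ∀ {A : Set} → (A → A → Bool) → List A → Bool
independent adj' [] = true
independent adj' (u ∷ us) = allᵇ (λ v → not (adj' u v)) us ∧ independent adj' us

indepSets : ∀ {n} (G : Graph n) (a : Fin n → ℕ) → List (List (Vtx n a))
indepSets {n} G a = filterᵇ (independent (extAdj G a)) (subsets (extVerts n a))

countIndepN : ∀ {n} (G : Graph n) (a : Fin n → ℕ) → ℕ
countIndepN {n} G a = length (filterᵇ (λ I → ⌊ length I N.≟ n ⌋) (indepSets G a))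

-- Multilinear polynomials (degree ≤ 1 in each variable) in n variables with
-- coefficients in A:  ML A (suc n) = (p₀ , p₁) represents p₀ + a₀ · p₁.
ML : ∀ {c : Level} → Set c → ℕ → Set c
ML A zero = A
ML A (suc n) = ML A n × ML A n

module Over {c ℓ : Level} (R : CommutativeRing c ℓ) where
  open CommutativeRing R

  fromℕ : ℕ → Carrier
  fromℕ zero = 0#
  fromℕ (suc k) = 1# + fromℕ k

  pow : Carrier → ℕ → Carrier
  pow x zero = 1#
  pow x (suc k) = x * pow x k

  sumR : List Carrier → Carrier
  sumR = foldr _+_ 0#

  prodR : List Carrier → Carrier
  prodR = foldr _*_ 1#

  evalML : ∀ {n} → ML Carrier n → (Fin n → Carrier) → Carrier
  evalML {zero} p b = p
  evalML {suc n} (p₀ , p₁) b = evalML p₀ (λ i → b (fs i)) + b fz * evalML p₁ (λ i → b (fs i))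

  IsAssocPoly : ∀ {n} → Graph n → ML Carrier n → Set ℓ
  IsAssocPoly {n} G f = (b : Fin n → ℕ) → (∀ i → 2 N.≤ b i) →
                        evalML f (λ i → fromℕ (b i)) ≈ fromℕ (countIndepN G b)

  Ptilde : ∀ {n} (G : Graph n) (a : Fin n → ℕ) → (Fin n → Carrier) → Carrier
  Ptilde G a x = sumR (map (λ I → prodR (map (λ u → x (proj₁ u)) I)) (indepSets G a))

  U : ∀ {n} (G : Graph n) (a : Fin n → ℕ) → Carrier → Carrier
  U G a x = sumR (map (λ I → pow (- x) (length I)) (indepSets G a))

  prodFin : ∀ {n} → (Fin n → Carrier) → Carrier
  prodFin {n} x = prodR (map x (allFin n))

-- An independent set of G(a₁,…,aₙ) takes at most one vertex from each clique K_{aᵢ}: nothing, one of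
-- its aᵢ - 1 non-root vertices, or its root vᵢ, and the chosen roots must be independent in G.
-- Hence P̃(x) = Σ_R Π_{i∈R} xᵢ Π_{i∉R} (1 + (aᵢ - 1) xᵢ) over independent sets R of G, while the
-- number of n-vertex independent sets is Σ_R Π_{i∉R} (bᵢ - 1).  The latter expression is a
-- multilinear polynomial in b agreeing with fₙ at all integer points bᵢ ≥ 2, so it is fₙ itself.
-- Writing 1 + (aᵢ - 1) xᵢ = xᵢ (aᵢ + yᵢ - 1) when xᵢ yᵢ = 1 gives P̃(x) = Π xᵢ · fₙ(a + y), and
-- U is the specialisation xᵢ = -x.
module Submission where

open import Defs hiding (sym)
open import Level using (Level)
open import Data.Nat using (ℕ; _≤_; zero; suc; z≤n; s≤s)
import Data.Nat as N
import Data.Nat.Properties as NP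
open import Data.Fin using (Fin; toℕ) renaming (zero to fz; suc to fs)
import Data.Fin as F
import Data.Fin.Properties as FP
import Data.Vec.Functional as Vector
open import Data.Bool using (Bool; true; false; _∧_; _∨_; not)
import Data.Bool.Properties as BP
open import Data.List using (List; []; _∷_; _++_; map; length; concatMap; allFin; filterᵇ)
import Data.List.Properties as LP
open import Data.List.Relation.Unary.All as All using (All; []; _∷_)
import Data.List.Relation.Unary.All.Properties as AllP
open import Data.List.Relation.Unary.AllPairs using (AllPairs; []; _∷_)
import Data.List.Relation.Unary.Unique.Propositional.Properties as UniqueP
open import Data.Product using (_,_; proj₁; _×_)
open import Relation.Nullary using (yes; no)
open import Relation.Nullary.Decidable using (⌊_⌋)
open import Data.Empty using (⊥-elim)
import Relation.Binary.PropositionalEquality as P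
open P using (_≡_; _≢_)
open import Function using (_∘_; Equivalence)
open import Algebra.Bundles using (CommutativeRing)

_∪_ : ∀ {A : Set} → (A → Bool) → (A → Bool) → A → Bool
(F ∪ F′) v = F v ∨ F′ v

-- Via _≡ᵇ_ rather than _≟_ so that exactly (suc k) ∘ suc reduces to exactly k.
exactly : ℕ → ℕ → Bool
exactly k m = m N.≡ᵇ k

≟-exactly : ∀ k m → ⌊ m N.≟ k ⌋ ≡ exactly k m
≟-exactly k m with m N.≟ k
... | yes m≡k = P.sym (Equivalence.to BP.T-≡ (NP.≡⇒≡ᵇ m k m≡k))
... | no  m≢k = P.sym (BP.¬-not (λ e → m≢k (NP.≡ᵇ⇒≡ m k (Equivalence.from BP.T-≡ e))))

allFin-suc : ∀ n → allFin (suc n) ≡ fz ∷ map fs (allFin n)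
allFin-suc n = P.cong (fz ∷_) (P.sym (LP.map-tabulate (λ i → i) fs))

length-allFin : ∀ n → length (allFin n) ≡ n
length-allFin n = LP.length-tabulate (λ i → i)

allᵇ-true : ∀ {A : Set} (T : List A) → allᵇ (λ _ → true) T ≡ true
allᵇ-true []      = P.refl
allᵇ-true (_ ∷ T) = allᵇ-true T

allᵇ-not-∪ : ∀ {A : Set} (F F′ : A → Bool) T →
             allᵇ (not ∘ (F ∪ F′)) T ≡ allᵇ (not ∘ F) T ∧ allᵇ (not ∘ F′) T
allᵇ-not-∪ F F′ []      = P.refl
allᵇ-not-∪ F F′ (v ∷ T) with F v | F′ v
... | true  | _     = P.refl
... | false | true  = P.sym (BP.∧-zeroʳ (allᵇ (not ∘ F) T))
... | false | false = allᵇ-not-∪ F F′ T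

record RootSplit (m : ℕ) : Set where
  field
    root            : Fin m
    others          : List (Fin m)
    allFin≡         : allFin m ≡ root ∷ others
    root-isZero     : isZero root ≡ true
    others-nonZero  : All (λ j → isZero j ≡ false) others

rootSplit : ∀ {m} → 1 ≤ m → RootSplit m
rootSplit {suc k} _ = record
  { root = fz ; others = map fs (allFin k) ; allFin≡ = allFin-suc k
  ; root-isZero = P.refl ; others-nonZero = AllP.map⁺ (All.universal (λ _ → P.refl) (allFin k)) }

module _ {c ℓ : Level} (R : CommutativeRing c ℓ) where
  open CommutativeRing R
  open Over R
  open import Relation.Binary.Reasoning.Setoid setoid
  open import Algebra.Solver.Ring.NaturalCoefficients.Default commutativeSemiring
  open import Algebra.Properties.Ring ring using (-‿distribˡ-*; -‿distribʳ-*; -‿involutive; +-cancelʳ)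

  guard : Bool → Carrier → Carrier
  guard true  r = r
  guard false r = 0#

  guard-cong : ∀ b {r s} → r ≈ s → guard b r ≈ guard b s
  guard-cong true  r≈s = r≈s
  guard-cong false r≈s = refl

  guard-zero : ∀ b {r} → r ≈ 0# → guard b r ≈ 0#
  guard-zero true  r≈0 = r≈0
  guard-zero false r≈0 = refl

  guard-*ˡ : ∀ b r s → guard b (r * s) ≈ r * guard b s
  guard-*ˡ true  r s = refl
  guard-*ˡ false r s = sym (zeroʳ r)

  guard-*ʳ : ∀ b r s → guard b (r * s) ≈ guard b r * s
  guard-*ʳ true  r s = refl
  guard-*ʳ false r s = sym (zeroˡ s)

  guard-∧ : ∀ b d r → guard (b ∧ d) r ≡ guard b (guard d r)
  guard-∧ true  d r = P.refl
  guard-∧ false d r = P.refl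

  guard-∧-* : ∀ b d r s → guard (b ∧ d) (r * s) ≈ guard b (r * guard d s)
  guard-∧-* true  d r s = guard-*ˡ d r s
  guard-∧-* false d r s = refl

  -‿*-‿ : ∀ x y → - x * - y ≈ x * y
  -‿*-‿ x y = begin
    - x * - y      ≈⟨ -‿distribʳ-* (- x) y ⟨
    - (- x * y)    ≈⟨ -‿cong (-‿distribˡ-* x y) ⟨
    - (- (x * y))  ≈⟨ -‿involutive (x * y) ⟩
    x * y          ∎

  fromℕ-pred : ∀ k → fromℕ k ≈ fromℕ (suc k) - 1#
  fromℕ-pred k = begin
    fromℕ k                  ≈⟨ +-identityʳ (fromℕ k) ⟨
    fromℕ k + 0#             ≈⟨ +-congˡ (-‿inverseʳ 1#) ⟨
    fromℕ k + (1# + - 1#)    ≈⟨ solve 3 (λ r o m → r :+ (o :+ m) := (o :+ r) :+ m) refl (fromℕ k) 1# (- 1#) ⟩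
    (1# + fromℕ k) + - 1#    ∎

  sumR-map-++ : ∀ {A : Set} (h : A → Carrier) xs ys →
                sumR (map h (xs ++ ys)) ≈ sumR (map h xs) + sumR (map h ys)
  sumR-map-++ h []       ys = sym (+-identityˡ _)
  sumR-map-++ h (x ∷ xs) ys = trans (+-congˡ (sumR-map-++ h xs ys)) (sym (+-assoc _ _ _))

  sumR-map-cong : ∀ {A : Set} {h h′ : A → Carrier} → (∀ T → h T ≈ h′ T) → ∀ L →
                  sumR (map h L) ≈ sumR (map h′ L)
  sumR-map-cong h≈h′ []      = refl
  sumR-map-cong h≈h′ (T ∷ L) = +-cong (h≈h′ T) (sumR-map-cong h≈h′ L)

  sumR-map-*ˡ : ∀ {A : Set} r (h : A → Carrier) L → sumR (map (λ T → r * h T) L) ≈ r * sumR (map h L)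
  sumR-map-*ˡ r h []      = sym (zeroʳ r)
  sumR-map-*ˡ r h (T ∷ L) = trans (+-congˡ (sumR-map-*ˡ r h L)) (sym (distribˡ r _ _))

  sumR-map-zero : ∀ {A : Set} (L : List A) → sumR (map (λ _ → 0#) L) ≈ 0#
  sumR-map-zero []      = refl
  sumR-map-zero (_ ∷ L) = trans (+-identityˡ _) (sumR-map-zero L)

  sumR-map-guard-* : ∀ {A : Set} b r (h : A → Carrier) L →
                     sumR (map (λ T → guard b (r * h T)) L) ≈ guard b (r * sumR (map h L))
  sumR-map-guard-* true  r h L = sumR-map-*ˡ r h L
  sumR-map-guard-* false r h L = sumR-map-zero L

  sumR-filter : ∀ {A : Set} (p : A → Bool) (h : A → Carrier) L →
                sumR (map h (filterᵇ p L)) ≈ sumR (map (λ T → guard (p T) (h T)) L)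
  sumR-filter p h []      = refl
  sumR-filter p h (T ∷ L) with p T
  ... | true  = +-congˡ (sumR-filter p h L)
  ... | false = trans (sumR-filter p h L) (sym (+-identityˡ _))

  fromℕ-length-filter : ∀ {A : Set} (p : A → Bool) L →
                        fromℕ (length (filterᵇ p L)) ≈ sumR (map (λ T → guard (p T) 1#) L)
  fromℕ-length-filter p []      = refl
  fromℕ-length-filter p (T ∷ L) with p T
  ... | true  = +-congˡ (fromℕ-length-filter p L)
  ... | false = trans (fromℕ-length-filter p L) (sym (+-identityˡ _))

  prodR-map-const : ∀ {A : Set} z (L : List A) → prodR (map (λ _ → z) L) ≡ pow z (length L)
  prodR-map-const z []      = P.refl
  prodR-map-const z (_ ∷ L) = P.cong (z *_) (prodR-map-const z L)

  prodR-map-one : ∀ {A : Set} (L : List A) → prodR (map (λ _ → 1#) L) ≈ 1#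
  prodR-map-one []      = refl
  prodR-map-one (_ ∷ L) = trans (*-identityˡ _) (prodR-map-one L)

  -- rootSum adj ν ρ is F σ: every clique i ∈ is contributes no vertex (weight 1), a non-root vertex
  -- (total weight ν i) or its root (weight ρ i, allowed only outside F, and then the adj-neighbours
  -- of i are forbidden); σ selects the admissible numbers of chosen vertices.
  rootSum : ∀ {n} → (Fin n → Fin n → Bool) → (ν ρ : Fin n → Carrier) →
            List (Fin n) → (Fin n → Bool) → (ℕ → Bool) → Carrier
  rootSum adj ν ρ []       F σ = guard (σ 0) 1#
  rootSum adj ν ρ (i ∷ is) F σ =
    rootSum adj ν ρ is F σ + ν i * rootSum adj ν ρ is F (σ ∘ suc)
    + guard (not (F i)) (ρ i * rootSum adj ν ρ is (F ∪ adj i) (σ ∘ suc))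

  rootSum-cong : ∀ {n} adj {ν ν′ : Fin n → Carrier} ρ → (∀ i → ν i ≈ ν′ i) → ∀ is F σ →
                 rootSum adj ν ρ is F σ ≈ rootSum adj ν′ ρ is F σ
  rootSum-cong adj ρ ν≈ν′ []       F σ = refl
  rootSum-cong adj ρ ν≈ν′ (i ∷ is) F σ =
    +-cong (+-cong (rootSum-cong adj ρ ν≈ν′ is F σ) (*-cong (ν≈ν′ i) (rootSum-cong adj ρ ν≈ν′ is F (σ ∘ suc))))
           (guard-cong (not (F i)) (*-congˡ (rootSum-cong adj ρ ν≈ν′ is (F ∪ adj i) (σ ∘ suc))))

  rootSum-map-suc : ∀ {n} (adj : Fin (suc n) → Fin (suc n) → Bool) ν ρ is F σ →
                    rootSum adj ν ρ (map fs is) F σ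
                    ≡ rootSum (λ i k → adj (fs i) (fs k)) (ν ∘ fs) (ρ ∘ fs) is (F ∘ fs) σ
  rootSum-map-suc adj ν ρ []       F σ = P.refl
  rootSum-map-suc adj ν ρ (i ∷ is) F σ
    rewrite rootSum-map-suc adj ν ρ is F σ | rootSum-map-suc adj ν ρ is F (σ ∘ suc)
          | rootSum-map-suc adj ν ρ is (F ∪ adj (fs i)) (σ ∘ suc) = P.refl

  rootSum-exactly-overflow : ∀ {n} adj (ν ρ : Fin n → Carrier) {k} is F → length is ≤ k →
                             rootSum adj ν ρ is F (exactly (suc k)) ≈ 0#
  rootSum-exactly-overflow adj ν ρ []       F _        = refl
  rootSum-exactly-overflow adj ν ρ (i ∷ is) F (s≤s |is|≤k) = begin
    rootSum adj ν ρ is F _ + ν i * rootSum adj ν ρ is F _ + guard (not (F i)) (ρ i * rootSum adj ν ρ is _ _)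
      ≈⟨ +-cong (+-cong (rootSum-exactly-overflow adj ν ρ is F (NP.m≤n⇒m≤1+n |is|≤k))
                        (*-congˡ (rootSum-exactly-overflow adj ν ρ is F |is|≤k)))
                (guard-zero (not (F i)) (trans (*-congˡ (rootSum-exactly-overflow adj ν ρ is _ |is|≤k)) (zeroʳ _))) ⟩
    0# + ν i * 0# + 0#
      ≈⟨ solve 1 (λ v → con 0 :+ v :* con 0 :+ con 0 := con 0) refl (ν i) ⟩
    0# ∎

  rootSum-exactly-∷ : ∀ {n} adj (ν : Fin n → Carrier) i is F →
                      rootSum adj ν (λ _ → 1#) (i ∷ is) F (exactly (suc (length is)))
                      ≈ ν i * rootSum adj ν (λ _ → 1#) is F (exactly (length is))
                        + guard (not (F i)) (rootSum adj ν (λ _ → 1#) is (F ∪ adj i) (exactly (length is)))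
  rootSum-exactly-∷ adj ν i is F =
    trans (+-cong (+-congʳ (rootSum-exactly-overflow adj ν _ is F NP.≤-refl)) (guard-cong (not (F i)) (*-identityˡ _)))
          (+-congʳ (+-identityˡ _))

  -- Merging the empty and non-root choices into 1 + ν i = ρ i · ν′ i gives every clique a factor ρ i;
  -- after factoring out Π ρ each clique contributes exactly one vertex.
  rootSum-homogenise : ∀ {n} adj (ν ρ ν′ : Fin n → Carrier) → (∀ i → 1# + ν i ≈ ρ i * ν′ i) → ∀ is F →
                       rootSum adj ν ρ is F (λ _ → true)
                       ≈ prodR (map ρ is) * rootSum adj ν′ (λ _ → 1#) is F (exactly (length is))
  rootSum-homogenise adj ν ρ ν′ 1+ν≈ρν′ []       F = sym (*-identityˡ 1#)
  rootSum-homogenise adj ν ρ ν′ 1+ν≈ρν′ (i ∷ is) F = begin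
    H F + ν i * H F + guard g (ρ i * H F′)
      ≈⟨ +-cong (+-cong IH (*-congˡ IH)) (guard-cong g (*-congˡ IH′)) ⟩
    Π * Ψ + ν i * (Π * Ψ) + guard g (ρ i * (Π * Ψ′))
      ≈⟨ +-congˡ (trans (guard-*ˡ g (ρ i) _) (*-congˡ (guard-*ˡ g Π Ψ′))) ⟩
    Π * Ψ + ν i * (Π * Ψ) + ρ i * (Π * guard g Ψ′)
      ≈⟨ solve 5 (λ v p s r t → p :* s :+ v :* (p :* s) :+ r :* (p :* t) := (con 1 :+ v) :* (p :* s) :+ r :* (p :* t))
               refl (ν i) Π Ψ (ρ i) (guard g Ψ′) ⟩
    (1# + ν i) * (Π * Ψ) + ρ i * (Π * guard g Ψ′)
      ≈⟨ +-congʳ (*-congʳ (1+ν≈ρν′ i)) ⟩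
    ρ i * ν′ i * (Π * Ψ) + ρ i * (Π * guard g Ψ′)
      ≈⟨ solve 5 (λ r v p s t → r :* v :* (p :* s) :+ r :* (p :* t) := r :* p :* (v :* s :+ t))
               refl (ρ i) (ν′ i) Π Ψ (guard g Ψ′) ⟩
    ρ i * Π * (ν′ i * Ψ + guard g Ψ′)
      ≈⟨ *-congˡ (rootSum-exactly-∷ adj ν′ i is F) ⟨
    ρ i * Π * rootSum adj ν′ (λ _ → 1#) (i ∷ is) F (exactly (suc (length is))) ∎
    where
    g  = not (F i)
    F′ = F ∪ adj i
    H : (Fin _ → Bool) → Carrier
    H F″ = rootSum adj ν ρ is F″ (λ _ → true)
    Π  = prodR (map ρ is)
    Ψ  = rootSum adj ν′ (λ _ → 1#) is F (exactly (length is))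
    Ψ′ = rootSum adj ν′ (λ _ → 1#) is F′ (exactly (length is))
    IH  = rootSum-homogenise adj ν ρ ν′ 1+ν≈ρν′ is F
    IH′ = rootSum-homogenise adj ν ρ ν′ 1+ν≈ρν′ is F′

  addML : ∀ {n} → ML Carrier n → ML Carrier n → ML Carrier n
  addML {zero}  p         q         = p + q
  addML {suc n} (p₀ , p₁) (q₀ , q₁) = addML p₀ q₀ , addML p₁ q₁

  scaleML : ∀ {n} → Carrier → ML Carrier n → ML Carrier n
  scaleML {zero}  r p         = r * p
  scaleML {suc n} r (p₀ , p₁) = scaleML r p₀ , scaleML r p₁

  evalML-add : ∀ {n} (p q : ML Carrier n) z → evalML (addML p q) z ≈ evalML p z + evalML q z
  evalML-add {zero}  p         q         z = refl
  evalML-add {suc n} (p₀ , p₁) (q₀ , q₁) z =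
    trans (+-cong (evalML-add p₀ q₀ (z ∘ fs)) (*-congˡ (evalML-add p₁ q₁ (z ∘ fs))))
          (solve 5 (λ a b c d e → (a :+ b) :+ e :* (c :+ d) := (a :+ e :* c) :+ (b :+ e :* d)) refl
                 (evalML p₀ (z ∘ fs)) (evalML q₀ (z ∘ fs)) (evalML p₁ (z ∘ fs)) (evalML q₁ (z ∘ fs)) (z fz))

  evalML-scale : ∀ {n} r (p : ML Carrier n) z → evalML (scaleML r p) z ≈ r * evalML p z
  evalML-scale {zero}  r p         z = refl
  evalML-scale {suc n} r (p₀ , p₁) z =
    trans (+-cong (evalML-scale r p₀ (z ∘ fs)) (*-congˡ (evalML-scale r p₁ (z ∘ fs))))
          (solve 4 (λ r a b e → r :* a :+ e :* (r :* b) := r :* (a :+ e :* b)) refl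
                 r (evalML p₀ (z ∘ fs)) (evalML p₁ (z ∘ fs)) (z fz))

  -- Expansion of rootSum along clique 0 with ν = z - 1 and ρ = 1 is affine in z₀.
  rootPoly : ∀ {n} → (Fin n → Fin n → Bool) → (Fin n → Bool) → (ℕ → Bool) → ML Carrier n
  rootPoly {zero}  adj F σ = guard (σ 0) 1#
  rootPoly {suc n} adj F σ =
    addML (addML (P (F ∘ fs) σ) (scaleML (- 1#) (P (F ∘ fs) (σ ∘ suc))))
          (scaleML (guard (not (F fz)) 1#) (P ((F ∪ adj fz) ∘ fs) (σ ∘ suc)))
    , P (F ∘ fs) (σ ∘ suc)
    where
    P : (Fin n → Bool) → (ℕ → Bool) → ML Carrier n
    P = rootPoly (λ i k → adj (fs i) (fs k))

  evalML-rootPoly : ∀ {n} adj F σ (z : Fin n → Carrier) →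
                    evalML (rootPoly adj F σ) z ≈ rootSum adj (λ i → z i - 1#) (λ _ → 1#) (allFin n) F σ
  evalML-rootPoly {zero}  adj F σ z = refl
  evalML-rootPoly {suc n} adj F σ z = begin
    evalML (rootPoly adj F σ) z
      ≈⟨ +-cong (trans (evalML-add _ _ (z ∘ fs))
                       (+-cong (trans (evalML-add _ _ (z ∘ fs)) (+-congˡ (evalML-scale _ _ (z ∘ fs))))
                               (evalML-scale _ _ (z ∘ fs))))
                refl ⟩
    (E₀ σ + - 1# * E₀ (σ ∘ suc) + guard g 1# * E₁) + z fz * E₀ (σ ∘ suc)
      ≈⟨ +-cong (+-cong (+-cong (IH (F ∘ fs) σ) (*-congˡ (IH (F ∘ fs) (σ ∘ suc)))) (*-congˡ (IH _ (σ ∘ suc))))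
                (*-congˡ (IH (F ∘ fs) (σ ∘ suc))) ⟩
    (R₀ σ + - 1# * R₀ (σ ∘ suc) + guard g 1# * R₁) + z fz * R₀ (σ ∘ suc)
      ≈⟨ solve 5 (λ a b c m e → a :+ m :* b :+ c :+ e :* b := a :+ (e :+ m) :* b :+ c)
               refl (R₀ σ) (R₀ (σ ∘ suc)) (guard g 1# * R₁) (- 1#) (z fz) ⟩
    R₀ σ + (z fz - 1#) * R₀ (σ ∘ suc) + guard g 1# * R₁
      ≈⟨ +-congˡ (guard-*ʳ g 1# R₁) ⟨
    R₀ σ + (z fz - 1#) * R₀ (σ ∘ suc) + guard g (1# * R₁)
      ≡⟨ expand ⟨
    rootSum adj (λ i → z i - 1#) (λ _ → 1#) (fz ∷ map fs (allFin n)) F σ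
      ≡⟨ P.cong (λ is → rootSum adj (λ i → z i - 1#) (λ _ → 1#) is F σ) (P.sym (allFin-suc n)) ⟩
    rootSum adj (λ i → z i - 1#) (λ _ → 1#) (allFin (suc n)) F σ ∎
    where
    g = not (F fz)
    adj′ : Fin n → Fin n → Bool
    adj′ i k = adj (fs i) (fs k)
    E₀ : (ℕ → Bool) → Carrier
    E₀ s = evalML (rootPoly adj′ (F ∘ fs) s) (z ∘ fs)
    E₁ = evalML (rootPoly adj′ ((F ∪ adj fz) ∘ fs) (σ ∘ suc)) (z ∘ fs)
    IH : ∀ F′ s → evalML (rootPoly adj′ F′ s) (z ∘ fs) ≈ rootSum adj′ (λ i → z (fs i) - 1#) (λ _ → 1#) (allFin n) F′ s
    IH F′ s = evalML-rootPoly adj′ F′ s (z ∘ fs)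
    R₀ : (ℕ → Bool) → Carrier
    R₀ s = rootSum adj′ (λ i → z (fs i) - 1#) (λ _ → 1#) (allFin n) (F ∘ fs) s
    R₁ = rootSum adj′ (λ i → z (fs i) - 1#) (λ _ → 1#) (allFin n) ((F ∪ adj fz) ∘ fs) (σ ∘ suc)
    expand : rootSum adj (λ i → z i - 1#) (λ _ → 1#) (fz ∷ map fs (allFin n)) F σ
             ≡ R₀ σ + (z fz - 1#) * R₀ (σ ∘ suc) + guard g (1# * R₁)
    expand rewrite rootSum-map-suc adj (λ i → z i - 1#) (λ _ → 1#) (allFin n) F σ
                 | rootSum-map-suc adj (λ i → z i - 1#) (λ _ → 1#) (allFin n) F (σ ∘ suc)
                 | rootSum-map-suc adj (λ i → z i - 1#) (λ _ → 1#) (allFin n) (F ∪ adj fz) (σ ∘ suc) = P.refl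

  -- The values at bᵢ ∈ {2, 3} already determine a multilinear polynomial over any commutative ring,
  -- because 3 - 2 = 1 is invertible.
  evalML-unique : ∀ {n} (p q : ML Carrier n) →
                  ((b : Fin n → ℕ) → (∀ i → 2 ≤ b i) → evalML p (fromℕ ∘ b) ≈ evalML q (fromℕ ∘ b)) →
                  ∀ z → evalML p z ≈ evalML q z
  evalML-unique {zero}  p         q         p≈q z = p≈q (λ ()) (λ ())
  evalML-unique {suc n} (p₀ , p₁) (q₀ , q₁) p≈q z =
    +-cong (evalML-unique p₀ q₀ p₀≈q₀ (z ∘ fs)) (*-congˡ (evalML-unique p₁ q₁ p₁≈q₁ (z ∘ fs)))
    where
    at : ∀ v → 2 ≤ v → (b : Fin n → ℕ) → (∀ i → 2 ≤ b i) →
         evalML p₀ (fromℕ ∘ b) + fromℕ v * evalML p₁ (fromℕ ∘ b) ≈ evalML q₀ (fromℕ ∘ b) + fromℕ v * evalML q₁ (fromℕ ∘ b)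
    at v 2≤v b 2≤b = p≈q (v Vector.∷ b) (λ { fz → 2≤v ; (fs i) → 2≤b i })

    p₁≈q₁ : (b : Fin n → ℕ) → (∀ i → 2 ≤ b i) → evalML p₁ (fromℕ ∘ b) ≈ evalML q₁ (fromℕ ∘ b)
    p₁≈q₁ b 2≤b = +-cancelʳ (P₀ + two * P₁) P₁ Q₁ (begin
      P₁ + (P₀ + two * P₁)  ≈⟨ solve 3 (λ a c t → c :+ (a :+ t :* c) := a :+ (con 1 :+ t) :* c) refl P₀ P₁ two ⟩
      P₀ + fromℕ 3 * P₁     ≈⟨ at 3 (s≤s (s≤s z≤n)) b 2≤b ⟩
      Q₀ + fromℕ 3 * Q₁     ≈⟨ solve 3 (λ a c t → a :+ (con 1 :+ t) :* c := c :+ (a :+ t :* c)) refl Q₀ Q₁ two ⟩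
      Q₁ + (Q₀ + two * Q₁)  ≈⟨ +-congˡ (at 2 NP.≤-refl b 2≤b) ⟨
      Q₁ + (P₀ + two * P₁)  ∎)
      where
      two = fromℕ 2
      P₀ = evalML p₀ (fromℕ ∘ b)
      P₁ = evalML p₁ (fromℕ ∘ b)
      Q₀ = evalML q₀ (fromℕ ∘ b)
      Q₁ = evalML q₁ (fromℕ ∘ b)

    p₀≈q₀ : (b : Fin n → ℕ) → (∀ i → 2 ≤ b i) → evalML p₀ (fromℕ ∘ b) ≈ evalML q₀ (fromℕ ∘ b)
    p₀≈q₀ b 2≤b = +-cancelʳ (fromℕ 2 * evalML q₁ (fromℕ ∘ b)) _ _
      (trans (+-congˡ (*-congˡ (sym (p₁≈q₁ b 2≤b)))) (at 2 NP.≤-refl b 2≤b))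

  weightedIndepSum : ∀ {n} (G : Graph n) (a : Fin n → ℕ) → (Fin n → Carrier) → (ℕ → Bool) → Carrier
  weightedIndepSum G a x σ = sumR (map (λ I → guard (σ (length I)) (prodR (map (x ∘ proj₁) I))) (indepSets G a))

  module CliqueExtension {n} (G : Graph n) (a : Fin n → ℕ) (x : Fin n → Carrier) where
    V : Set
    V = Vtx n a

    A : V → V → Bool
    A = extAdj G a

    weight : List V → Carrier
    weight T = prodR (map (x ∘ proj₁) T)

    admissible : (V → Bool) → (ℕ → Bool) → List V → Bool
    admissible F σ T = allᵇ (not ∘ F) T ∧ (independent A T ∧ σ (length T))

    indepSum : List V → (V → Bool) → (ℕ → Bool) → Carrier
    indepSum L F σ = sumR (map (λ T → guard (admissible F σ T) (weight T)) (subsets L))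

    admissible-∷ : ∀ F σ u T → admissible F σ (u ∷ T) ≡ not (F u) ∧ admissible (F ∪ A u) (σ ∘ suc) T
    admissible-∷ F σ u T rewrite allᵇ-not-∪ F (A u) T with F u
    ... | true  = P.refl
    ... | false = P.trans (P.cong (av ∧_) (BP.∧-assoc al ind s)) (P.sym (BP.∧-assoc av al (ind ∧ s)))
      where
      av  = allᵇ (not ∘ F) T
      al  = allᵇ (not ∘ A u) T
      ind = independent A T
      s   = σ (suc (length T))

    indepSum-∷ : ∀ u L F σ →
                 indepSum (u ∷ L) F σ ≈ indepSum L F σ + guard (not (F u)) (x (proj₁ u) * indepSum L (F ∪ A u) (σ ∘ suc))
    indepSum-∷ u L F σ = begin
      sumR (map term (subsets L ++ map (u ∷_) (subsets L)))
        ≈⟨ sumR-map-++ term (subsets L) (map (u ∷_) (subsets L)) ⟩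
      indepSum L F σ + sumR (map term (map (u ∷_) (subsets L)))
        ≡⟨ P.cong (λ ts → indepSum L F σ + sumR ts) (LP.map-∘ (subsets L)) ⟨
      indepSum L F σ + sumR (map (term ∘ (u ∷_)) (subsets L))
        ≈⟨ +-congˡ (sumR-map-cong term-∷ (subsets L)) ⟩
      indepSum L F σ + sumR (map (λ T → guard (not (F u)) (x (proj₁ u) * term′ T)) (subsets L))
        ≈⟨ +-congˡ (sumR-map-guard-* (not (F u)) (x (proj₁ u)) term′ (subsets L)) ⟩
      indepSum L F σ + guard (not (F u)) (x (proj₁ u) * indepSum L (F ∪ A u) (σ ∘ suc)) ∎
      where
      term term′ : List V → Carrier
      term  T = guard (admissible F σ T) (weight T)
      term′ T = guard (admissible (F ∪ A u) (σ ∘ suc) T) (weight T)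
      term-∷ : ∀ T → term (u ∷ T) ≈ guard (not (F u)) (x (proj₁ u) * term′ T)
      term-∷ T = trans (reflexive (P.cong (λ b → guard b (weight (u ∷ T))) (admissible-∷ F σ u T)))
                       (guard-∧-* (not (F u)) _ (x (proj₁ u)) (weight T))

    indepSum-cong : ∀ L {F F′} σ → All (λ v → F v ≡ F′ v) L → indepSum L F σ ≈ indepSum L F′ σ
    indepSum-cong []      σ []          = refl
    indepSum-cong (u ∷ L) {F} {F′} σ (Fu≡F′u ∷ F≡F′) = begin
      indepSum (u ∷ L) F σ
        ≈⟨ indepSum-∷ u L F σ ⟩
      indepSum L F σ + guard (not (F u)) (x (proj₁ u) * indepSum L (F ∪ A u) (σ ∘ suc))
        ≡⟨ P.cong (λ b → indepSum L F σ + guard (not b) (x (proj₁ u) * indepSum L (F ∪ A u) (σ ∘ suc))) Fu≡F′u ⟩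
      indepSum L F σ + guard (not (F′ u)) (x (proj₁ u) * indepSum L (F ∪ A u) (σ ∘ suc))
        ≈⟨ +-cong (indepSum-cong L σ F≡F′)
                  (guard-cong (not (F′ u)) (*-congˡ (indepSum-cong L (σ ∘ suc) (All.map (P.cong (_∨ A u _)) F≡F′)))) ⟩
      indepSum L F′ σ + guard (not (F′ u)) (x (proj₁ u) * indepSum L (F′ ∪ A u) (σ ∘ suc))
        ≈⟨ indepSum-∷ u L F′ σ ⟨
      indepSum (u ∷ L) F′ σ ∎

    indepSum-forbidden-++ : ∀ K L F σ → All (λ v → F v ≡ true) K → indepSum (K ++ L) F σ ≈ indepSum L F σ
    indepSum-forbidden-++ []      L F σ []              = refl
    indepSum-forbidden-++ (u ∷ K) L F σ (Fu≡true ∷ F≡true) = begin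
      indepSum (u ∷ K ++ L) F σ
        ≈⟨ indepSum-∷ u (K ++ L) F σ ⟩
      indepSum (K ++ L) F σ + guard (not (F u)) (x (proj₁ u) * indepSum (K ++ L) (F ∪ A u) (σ ∘ suc))
        ≡⟨ P.cong (λ b → indepSum (K ++ L) F σ + guard (not b) (x (proj₁ u) * indepSum (K ++ L) (F ∪ A u) (σ ∘ suc))) Fu≡true ⟩
      indepSum (K ++ L) F σ + 0#
        ≈⟨ +-identityʳ _ ⟩
      indepSum (K ++ L) F σ
        ≈⟨ indepSum-forbidden-++ K L F σ F≡true ⟩
      indepSum L F σ ∎

    indepSum-∷-clique : ∀ u K L F σ → All (λ v → A u v ≡ true) K →
                        indepSum (u ∷ K ++ L) F σ
                        ≈ indepSum (K ++ L) F σ + guard (not (F u)) (x (proj₁ u) * indepSum L (F ∪ A u) (σ ∘ suc))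
    indepSum-∷-clique u K L F σ K-adjacent =
      trans (indepSum-∷ u (K ++ L) F σ)
            (+-congˡ (guard-cong (not (F u)) (*-congˡ (indepSum-forbidden-++ K L (F ∪ A u) (σ ∘ suc)
              (All.map (λ {v} Auv≡true → P.trans (P.cong (F v ∨_) Auv≡true) (BP.∨-zeroʳ (F v))) K-adjacent)))))

    A-same-clique : ∀ i {j j′ : Fin (a i)} → j ≢ j′ → A (i , j) (i , j′) ≡ true
    A-same-clique i {j} {j′} j≢j′ with i F.≟ i | toℕ j N.≟ toℕ j′
    ... | yes _   | no _  = P.refl
    ... | yes _   | yes e = ⊥-elim (j≢j′ (FP.toℕ-injective e))
    ... | no i≢i  | _     = ⊥-elim (i≢i P.refl)

    A-other-clique : ∀ {i k} (j : Fin (a i)) (j′ : Fin (a k)) → i ≢ k →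
                     A (i , j) (k , j′) ≡ isZero j ∧ (isZero j′ ∧ adj G i k)
    A-other-clique {i} {k} j j′ i≢k with i F.≟ k
    ... | yes i≡k = ⊥-elim (i≢k i≡k)
    ... | no _    = P.refl

    rootMask : (Fin n → Bool) → V → Bool
    rootMask Fr (k , j) = isZero j ∧ Fr k

    indepSum-nonRoots : ∀ i Fr σ L → All (λ v → i ≢ proj₁ v) L → (J : List (Fin (a i))) →
                        All (λ j → isZero j ≡ false) J → AllPairs _≢_ J →
                        indepSum (map (i ,_) J ++ L) (rootMask Fr) σ
                        ≈ indepSum L (rootMask Fr) σ + fromℕ (length J) * x i * indepSum L (rootMask Fr) (σ ∘ suc)
    indepSum-nonRoots i Fr σ L L-outside [] [] [] =
      sym (trans (+-congˡ (trans (*-congʳ (zeroˡ (x i))) (zeroˡ _))) (+-identityʳ _))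
    indepSum-nonRoots i Fr σ L L-outside (j ∷ J) (j-nonRoot ∷ J-nonRoot) (j≢J ∷ J-distinct) = begin
      indepSum ((i , j) ∷ map (i ,_) J ++ L) F σ
        ≈⟨ indepSum-∷-clique (i , j) (map (i ,_) J) L F σ (AllP.map⁺ (All.map (A-same-clique i) j≢J)) ⟩
      indepSum (map (i ,_) J ++ L) F σ + guard (not (isZero j ∧ Fr i)) (x i * indepSum L (F ∪ A (i , j)) (σ ∘ suc))
        ≡⟨ P.cong (λ b → indepSum (map (i ,_) J ++ L) F σ + guard (not (b ∧ Fr i)) (x i * indepSum L (F ∪ A (i , j)) (σ ∘ suc)))
                  j-nonRoot ⟩
      indepSum (map (i ,_) J ++ L) F σ + x i * indepSum L (F ∪ A (i , j)) (σ ∘ suc)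
        ≈⟨ +-cong (indepSum-nonRoots i Fr σ L L-outside J J-nonRoot J-distinct)
                  (*-congˡ (indepSum-cong L (σ ∘ suc) unaffected)) ⟩
      S + fromℕ (length J) * x i * S′ + x i * S′
        ≈⟨ solve 4 (λ s l y s′ → s :+ l :* y :* s′ :+ y :* s′ := s :+ (con 1 :+ l) :* y :* s′) refl S (fromℕ (length J)) (x i) S′ ⟩
      S + (1# + fromℕ (length J)) * x i * S′ ∎
      where
      F  = rootMask Fr
      S  = indepSum L F σ
      S′ = indepSum L F (σ ∘ suc)
      unaffected : All (λ v → (F ∪ A (i , j)) v ≡ F v) L
      unaffected = All.map (λ { {k , j′} i≢k →
        P.trans (P.cong (F (k , j′) ∨_) (P.trans (A-other-clique j j′ i≢k) (P.cong (_∧ _) j-nonRoot)))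
                (BP.∨-identityʳ _) }) L-outside

    indepSum-clique : ∀ i Fr σ L → All (λ v → i ≢ proj₁ v) L → (r : Fin (a i)) (J : List (Fin (a i))) →
                      isZero r ≡ true → All (λ j → isZero j ≡ false) J → AllPairs _≢_ (r ∷ J) →
                      indepSum (map (i ,_) (r ∷ J) ++ L) (rootMask Fr) σ
                      ≈ indepSum L (rootMask Fr) σ + fromℕ (length J) * x i * indepSum L (rootMask Fr) (σ ∘ suc)
                        + guard (not (Fr i)) (x i * indepSum L (rootMask (Fr ∪ adj G i)) (σ ∘ suc))
    indepSum-clique i Fr σ L L-outside r J r-root J-nonRoot (r≢J ∷ J-distinct) = begin
      indepSum ((i , r) ∷ map (i ,_) J ++ L) F σ
        ≈⟨ indepSum-∷-clique (i , r) (map (i ,_) J) L F σ (AllP.map⁺ (All.map (A-same-clique i) r≢J)) ⟩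
      indepSum (map (i ,_) J ++ L) F σ + guard (not (isZero r ∧ Fr i)) (x i * indepSum L (F ∪ A (i , r)) (σ ∘ suc))
        ≡⟨ P.cong (λ b → indepSum (map (i ,_) J ++ L) F σ + guard (not (b ∧ Fr i)) (x i * indepSum L (F ∪ A (i , r)) (σ ∘ suc)))
                  r-root ⟩
      indepSum (map (i ,_) J ++ L) F σ + guard (not (Fr i)) (x i * indepSum L (F ∪ A (i , r)) (σ ∘ suc))
        ≈⟨ +-cong (indepSum-nonRoots i Fr σ L L-outside J J-nonRoot J-distinct)
                  (guard-cong (not (Fr i)) (*-congˡ (indepSum-cong L (σ ∘ suc) neighboursForbidden))) ⟩
      _ ∎
      where
      F = rootMask Fr
      neighboursForbidden : All (λ v → (F ∪ A (i , r)) v ≡ rootMask (Fr ∪ adj G i) v) L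
      neighboursForbidden = All.map (λ { {k , j′} i≢k →
        P.trans (P.cong (F (k , j′) ∨_) (P.trans (A-other-clique r j′ i≢k) (P.cong (_∧ _) r-root)))
                (P.sym (BP.∧-distribˡ-∨ (isZero j′) (Fr k) (adj G i k))) }) L-outside

    clique : Fin n → List V
    clique i = map (i ,_) (allFin (a i))

    concatMap-clique-outside : ∀ {i} is → All (i ≢_) is → All (λ v → i ≢ proj₁ v) (concatMap clique is)
    concatMap-clique-outside []       []              = []
    concatMap-clique-outside (k ∷ is) (i≢k ∷ i≢is) =
      AllP.++⁺ (AllP.map⁺ (All.universal (λ _ → i≢k) (allFin (a k)))) (concatMap-clique-outside is i≢is)

    module _ (a≥1 : ∀ i → 1 ≤ a i) where
      ν : Fin n → Carrier
      ν i = (fromℕ (a i) - 1#) * x i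

      indepSum-cliques : ∀ is Fr σ → AllPairs _≢_ is →
                         indepSum (concatMap clique is) (rootMask Fr) σ ≈ rootSum (adj G) ν x is Fr σ
      indepSum-cliques []       Fr σ []                  = +-identityʳ _
      indepSum-cliques (i ∷ is) Fr σ (i≢is ∷ is-distinct) = begin
        indepSum (clique i ++ L) (rootMask Fr) σ
          ≡⟨ P.cong (λ js → indepSum (map (i ,_) js ++ L) (rootMask Fr) σ) allFin≡ ⟩
        indepSum (map (i ,_) (root ∷ others) ++ L) (rootMask Fr) σ
          ≈⟨ indepSum-clique i Fr σ L (concatMap-clique-outside is i≢is) root others root-isZero others-nonZero
                             (P.subst (AllPairs _≢_) allFin≡ (UniqueP.allFin⁺ (a i))) ⟩
        _ + fromℕ (length others) * x i * _ + _
          ≈⟨ +-cong (+-cong (IH Fr σ) (*-cong (*-congʳ others-count) (IH Fr (σ ∘ suc))))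
                    (guard-cong (not (Fr i)) (*-congˡ (IH (Fr ∪ adj G i) (σ ∘ suc)))) ⟩
        rootSum (adj G) ν x (i ∷ is) Fr σ ∎
        where
        open RootSplit (rootSplit (a≥1 i))
        L = concatMap clique is
        IH : ∀ Fr′ σ′ → indepSum L (rootMask Fr′) σ′ ≈ rootSum (adj G) ν x is Fr′ σ′
        IH Fr′ σ′ = indepSum-cliques is Fr′ σ′ is-distinct
        others-count : fromℕ (length others) ≈ fromℕ (a i) - 1#
        others-count = trans (fromℕ-pred (length others))
          (reflexive (P.cong (λ m → fromℕ m - 1#) (P.trans (P.sym (P.cong length allFin≡)) (length-allFin (a i)))))

      weightedIndepSum≈rootSum : ∀ σ → weightedIndepSum G a x σ ≈ rootSum (adj G) ν x (allFin n) (λ _ → false) σ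
      weightedIndepSum≈rootSum σ = begin
        weightedIndepSum G a x σ
          ≈⟨ sumR-filter (independent A) _ (subsets (extVerts n a)) ⟩
        sumR (map (λ T → guard (independent A T) (guard (σ (length T)) (weight T))) (subsets (extVerts n a)))
          ≡⟨ P.cong sumR (LP.map-cong noneForbidden (subsets (extVerts n a))) ⟨
        indepSum (extVerts n a) (λ _ → false) σ
          ≈⟨ indepSum-cong (extVerts n a) σ (All.universal (λ (k , j) → P.sym (BP.∧-zeroʳ (isZero j))) (extVerts n a)) ⟩
        indepSum (concatMap clique (allFin n)) (rootMask (λ _ → false)) σ
          ≈⟨ indepSum-cliques (allFin n) (λ _ → false) σ (UniqueP.allFin⁺ n) ⟩
        rootSum (adj G) ν x (allFin n) (λ _ → false) σ ∎
        where
        noneForbidden : ∀ T → guard (admissible (λ _ → false) σ T) (weight T)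
                              ≡ guard (independent A T) (guard (σ (length T)) (weight T))
        noneForbidden T = P.trans (P.cong (λ b → guard (b ∧ (independent A T ∧ σ (length T))) (weight T)) (allᵇ-true T))
                                  (guard-∧ (independent A T) (σ (length T)) (weight T))

  countIndepN≈weightedIndepSum : ∀ {n} (G : Graph n) b → fromℕ (countIndepN G b) ≈ weightedIndepSum G b (λ _ → 1#) (exactly n)
  countIndepN≈weightedIndepSum {n} G b = trans (fromℕ-length-filter _ (indepSets G b))
    (sumR-map-cong (λ I → trans (reflexive (P.cong (λ β → guard β 1#) (≟-exactly n (length I))))
                                (guard-cong (exactly n (length I)) (sym (prodR-map-one I))))
                   (indepSets G b))

  module AssociatedPolynomial {n} (G : Graph n) (f : ML Carrier n) (f-assoc : IsAssocPoly G f) where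
    evalML-assoc : ∀ z → evalML f z ≈ rootSum (adj G) (λ i → z i - 1#) (λ _ → 1#) (allFin n) (λ _ → false) (exactly n)
    evalML-assoc z = trans (evalML-unique f (rootPoly (adj G) (λ _ → false) (exactly n)) agree z)
                           (evalML-rootPoly (adj G) (λ _ → false) (exactly n) z)
      where
      agree : (b : Fin n → ℕ) → (∀ i → 2 ≤ b i) →
              evalML f (fromℕ ∘ b) ≈ evalML (rootPoly (adj G) (λ _ → false) (exactly n)) (fromℕ ∘ b)
      agree b 2≤b = begin
        evalML f (fromℕ ∘ b)
          ≈⟨ f-assoc b 2≤b ⟩
        fromℕ (countIndepN G b)
          ≈⟨ countIndepN≈weightedIndepSum G b ⟩
        weightedIndepSum G b (λ _ → 1#) (exactly n)
          ≈⟨ CliqueExtension.weightedIndepSum≈rootSum G b (λ _ → 1#) (λ i → NP.≤-trans (s≤s z≤n) (2≤b i)) (exactly n) ⟩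
        rootSum (adj G) (λ i → (fromℕ (b i) - 1#) * 1#) (λ _ → 1#) (allFin n) (λ _ → false) (exactly n)
          ≈⟨ rootSum-cong (adj G) (λ _ → 1#) (λ i → *-identityʳ _) (allFin n) (λ _ → false) (exactly n) ⟩
        rootSum (adj G) (λ i → fromℕ (b i) - 1#) (λ _ → 1#) (allFin n) (λ _ → false) (exactly n)
          ≈⟨ evalML-rootPoly (adj G) (λ _ → false) (exactly n) (fromℕ ∘ b) ⟨
        evalML (rootPoly (adj G) (λ _ → false) (exactly n)) (fromℕ ∘ b) ∎

    Ptilde-formula : ∀ a → (∀ i → 2 ≤ a i) → (x y : Fin n → Carrier) → (∀ i → x i * y i ≈ 1#) →
                     Ptilde G a x ≈ prodFin x * evalML f (λ i → fromℕ (a i) + y i)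
    Ptilde-formula a 2≤a x y xy≈1 = begin
      weightedIndepSum G a x (λ _ → true)
        ≈⟨ CliqueExtension.weightedIndepSum≈rootSum G a x (λ i → NP.≤-trans (s≤s z≤n) (2≤a i)) (λ _ → true) ⟩
      rootSum (adj G) (λ i → (fromℕ (a i) - 1#) * x i) x (allFin n) (λ _ → false) (λ _ → true)
        ≈⟨ rootSum-homogenise (adj G) _ x (λ i → z i - 1#) 1+ν≈x[z-1] (allFin n) (λ _ → false) ⟩
      prodFin x * rootSum (adj G) (λ i → z i - 1#) (λ _ → 1#) (allFin n) (λ _ → false) (exactly (length (allFin n)))
        ≡⟨ P.cong (λ k → prodFin x * rootSum (adj G) (λ i → z i - 1#) (λ _ → 1#) (allFin n) (λ _ → false) (exactly k))
                  (length-allFin n) ⟩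
      prodFin x * rootSum (adj G) (λ i → z i - 1#) (λ _ → 1#) (allFin n) (λ _ → false) (exactly n)
        ≈⟨ *-congˡ (evalML-assoc z) ⟨
      prodFin x * evalML f z ∎
      where
      z : Fin n → Carrier
      z i = fromℕ (a i) + y i
      1+ν≈x[z-1] : ∀ i → 1# + (fromℕ (a i) - 1#) * x i ≈ x i * (z i - 1#)
      1+ν≈x[z-1] i = begin
        1# + (fromℕ (a i) - 1#) * x i         ≈⟨ +-congʳ (xy≈1 i) ⟨
        x i * y i + (fromℕ (a i) - 1#) * x i  ≈⟨ solve 4 (λ α m u v → u :* v :+ (α :+ m) :* u := u :* ((α :+ v) :+ m))
                                                       refl (fromℕ (a i)) (- 1#) (x i) (y i) ⟩
        x i * (z i - 1#)                      ∎

    U-formula : ∀ a → (∀ i → 2 ≤ a i) → (x y : Carrier) → x * y ≈ 1# →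
                U G a x ≈ pow (- x) n * evalML f (λ i → fromℕ (a i) - y)
    U-formula a 2≤a x y xy≈1 = begin
      U G a x
        ≡⟨ P.cong sumR (LP.map-cong (prodR-map-const (- x)) (indepSets G a)) ⟨
      Ptilde G a (λ _ → - x)
        ≈⟨ Ptilde-formula a 2≤a (λ _ → - x) (λ _ → - y) (λ _ → trans (-‿*-‿ x y) xy≈1) ⟩
      prodFin {n} (λ _ → - x) * evalML f (λ i → fromℕ (a i) - y)
        ≡⟨ P.cong (_* evalML f (λ i → fromℕ (a i) - y))
                  (P.trans (prodR-map-const (- x) (allFin n)) (P.cong (pow (- x)) (length-allFin n))) ⟩
      pow (- x) n * evalML f (λ i → fromℕ (a i) - y) ∎

corollary5p2 : ∀ {c ℓ : Level} (R : CommutativeRing c ℓ) →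
    let open CommutativeRing R in let open Over R in
    (n : ℕ) (G : Graph n) (a : Fin n → ℕ) → (∀ i → 2 ≤ a i) →
    (f : ML Carrier n) → IsAssocPoly G f →
    ((x y : Fin n → Carrier) → (∀ i → x i * y i ≈ 1#) →
       Ptilde G a x ≈ prodFin x * evalML f (λ i → fromℕ (a i) + y i))
    × ((x y : Carrier) → x * y ≈ 1# →
       U G a x ≈ pow (- x) n * evalML f (λ i → fromℕ (a i) - y))
corollary5p2 R n G a 2≤a f f-assoc = Ptilde-formula a 2≤a , U-formula a 2≤a
  where open AssociatedPolynomial R G f f-assoc
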